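{- Let $k\ge 3$ and $n\ge\max(3,k)$ be integers and let $R\in S_k$ be a non-monotone permutation pattern (i.e. neither $(1,2,\dots,k)$ nor $(k,\dots,2,1)$). If $\mathcal S\subseteq S_n$ is a family of permutations such that every $k$-element subset of $[n]$ follows the pattern $R$ in at least one $P\in\mathcal S$, then $|\mathcal S|\ge \log_2(n-k+2)$.
   Context: $S_n$ is the set of permutations of $[n]$, viewed as linear orderings $P=(p_1,\dots,p_n)$ of $[n]$; $pos(P,a)=i$ when $a=p_i$. A $k$-element set $\{a_1<\dots<a_k\}\subseteq[n]$ follows the pattern $R\in S_k$ in $P\in S_n$ if for all $i,j\in[k]$, $pos(P,a_i)<pos(P,a_j)$ iff $pos(R,i)<pos(R,j)$. -}

module Defs where

open import Data.Nat using (ℕ)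
open import Data.Fin using (Fin; _<_; opposite)
open import Data.Fin.Permutation using (Permutation′; _⟨$⟩ʳ_; _⟨$⟩ˡ_)
open import Data.Product using (_×_)
open import Relation.Binary.PropositionalEquality using (_≡_)
open import Relation.Nullary using (¬_)

-- A permutation P ∈ S_n as a linear ordering (p_1,…,p_n) of [n]:
-- P ⟨$⟩ʳ i = p_i (entry at position i), so pos(P,a) = P ⟨$⟩ˡ a.
-- [n] is represented by Fin n (0-based; order-isomorphic).
pos : ∀ {n} → Permutation′ n → Fin n → Fin n
pos P a = P ⟨$⟩ˡ a

-- A k-element subset {a_1 < … < a_k} of [n], given by its increasing enumeration.
StrictlyIncreasing : ∀ {k n} → (Fin k → Fin n) → Set
StrictlyIncreasing a = ∀ i j → i < j → a i < a j

Follows : ∀ {k n} → (Fin k → Fin n) → Permutation′ k → Permutation′ n → Set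
Follows a R P = ∀ i j → (pos P (a i) < pos P (a j) → pos R i < pos R j)
                      × (pos R i < pos R j → pos P (a i) < pos P (a j))

IsIncreasing : ∀ {k} → Permutation′ k → Set
IsIncreasing R = ∀ i → R ⟨$⟩ʳ i ≡ i

IsDecreasing : ∀ {k} → Permutation′ k → Set
IsDecreasing R = ∀ i → R ⟨$⟩ʳ i ≡ opposite i

NonMonotone : ∀ {k} → Permutation′ k → Set
NonMonotone R = ¬ IsIncreasing R × ¬ IsDecreasing R

-- A non-monotone pattern R has a gap: consecutive values i, i+1 whose positions in R are
-- separated by the position of some w (otherwise consecutive values sit at adjacent
-- positions, and injectivity forces all these steps in one direction).  Put d = n - k and
-- take the d + 2 points z_j = i + j and one further point c.  For j₁ < j₂ some k-set has
-- z_{j₁}, c, z_{j₂} in the roles of i, w, i+1 (fill the other roles with the lowest and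
-- highest available points), and a permutation showing that set in pattern R puts c
-- strictly between z_{j₁} and z_{j₂}.  So recording, for each permutation of the family,
-- on which side of c each z_j lies separates all d + 2 points: d + 2 ≤ 2^|S|.
module Submission where

open import Defs
open import Data.Nat using (ℕ; _≤_; _+_; _∸_; _^_)
open import Data.Fin using (Fin)
open import Data.Fin.Permutation using (Permutation′)
open import Data.Product using (∃-syntax)

open import Data.Nat using (zero; suc; z≤n; s≤s; s≤s⁻¹; _≤?_; NonZero)
import Data.Nat as ℕ
import Data.Nat.Properties as ℕ
open import Data.Nat.DivMod using (_mod_; m<n⇒m%n≡m)
open import Data.Fin using (zero; suc; _<_; toℕ; fromℕ<; inject₁; opposite; funToFin; finToFun)
import Data.Fin.Properties as Fin
open import Data.Fin.Permutation using (_⟨$⟩ʳ_; inverseʳ; inverseˡ)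
open import Data.Product using (_×_; _,_; proj₂; map₂)
open import Data.Sum using (_⊎_; inj₁; inj₂)
import Data.Sum as Sum
open import Data.Empty using (⊥-elim)
open import Function using (_∘_)
open import Relation.Binary.Definitions using (tri<; tri≈; tri>)
open import Relation.Binary.PropositionalEquality
open import Relation.Nullary using (¬_; Dec; yes; no; _×-dec_; _⊎-dec_)

Between : ∀ {n} → Fin n → Fin n → Fin n → Set
Between a b c = (a < b × b < c) ⊎ (c < b × b < a)

between? : ∀ {n} (a b c : Fin n) → Dec (Between a b c)
between? a b c = (a Fin.<? b ×-dec b Fin.<? c) ⊎-dec (c Fin.<? b ×-dec b Fin.<? a)

between⇒≢ˡ : ∀ {n} {a b c : Fin n} → Between a b c → a ≢ b
between⇒≢ˡ (inj₁ (a<b , _)) = Fin.<⇒≢ a<b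
between⇒≢ˡ (inj₂ (_ , b<a)) = Fin.<⇒≢ b<a ∘ sym

between⇒≢ʳ : ∀ {n} {a b c : Fin n} → Between a b c → b ≢ c
between⇒≢ʳ (inj₁ (_ , b<c)) = Fin.<⇒≢ b<c
between⇒≢ʳ (inj₂ (c<b , _)) = Fin.<⇒≢ c<b ∘ sym

between-cong : ∀ {n} {a a′ b b′ c c′ : Fin n} →
               a ≡ a′ → b ≡ b′ → c ≡ c′ → Between a b c → Between a′ b′ c′
between-cong refl refl refl btw = btw

follows-between : ∀ {k n} {a : Fin k → Fin n} {R P} → Follows a R P →
                  ∀ {i j l} → Between (pos R i) (pos R j) (pos R l) →
                  Between (pos P (a i)) (pos P (a j)) (pos P (a l))
follows-between follows {i} {j} {l} (inj₁ (i<j , j<l)) =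
  inj₁ (proj₂ (follows i j) i<j , proj₂ (follows j l) j<l)
follows-between follows {i} {j} {l} (inj₂ (l<j , j<i)) =
  inj₂ (proj₂ (follows l j) l<j , proj₂ (follows j i) j<i)

side : ∀ {n} → Fin n → Fin n → Fin 2
side c a with a Fin.<? c
... | yes _ = suc zero
... | no _  = zero

side-< : ∀ {n} {a c : Fin n} → a < c → side c a ≡ suc zero
side-< {a = a} {c} a<c with a Fin.<? c
... | yes _   = refl
... | no a≮c = ⊥-elim (a≮c a<c)

side-> : ∀ {n} {a c : Fin n} → c < a → side c a ≡ zero
side-> {a = a} {c} c<a with a Fin.<? c
... | yes a<c = ⊥-elim (Fin.<-asym a<c c<a)
... | no _    = refl

between⇒side≢ : ∀ {n} {a b c : Fin n} → Between a c b → side c a ≢ side c b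
between⇒side≢ (inj₁ (a<c , c<b)) eq with trans (sym (side-< a<c)) (trans eq (side-> c<b))
... | ()
between⇒side≢ (inj₂ (b<c , c<a)) eq with trans (sym (side-> c<a)) (trans eq (side-< b<c))
... | ()

signature : ∀ {m n} → (Fin m → Permutation′ n) → Fin n → Fin n → Fin (2 ^ m)
signature S c a = funToFin (λ t → side (pos (S t) c) (pos (S t) a))

signature-side : ∀ {m n} (S : Fin m → Permutation′ n) {c a b} →
                 signature S c a ≡ signature S c b →
                 ∀ t → side (pos (S t) c) (pos (S t) a) ≡ side (pos (S t) c) (pos (S t) b)
signature-side S {c} {a} {b} eq t = begin
  side (pos (S t) c) (pos (S t) a)  ≡⟨ Fin.finToFun-funToFin _ t ⟨
  finToFun (signature S c a) t      ≡⟨ cong (λ s → finToFun s t) eq ⟩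
  finToFun (signature S c b) t      ≡⟨ Fin.finToFun-funToFin _ t ⟩
  side (pos (S t) c) (pos (S t) b)  ∎
  where open ≡-Reasoning

separated⇒≤2^ : ∀ {N m n} (S : Fin m → Permutation′ n) (c : Fin n) (z : Fin N → Fin n) →
                (∀ j₁ j₂ → j₁ < j₂ →
                  ∃[ t ] Between (pos (S t) (z j₁)) (pos (S t) c) (pos (S t) (z j₂))) →
                N ≤ 2 ^ m
separated⇒≤2^ {N} {m} S c z separated with N ≤? 2 ^ m
... | yes N≤2^m = N≤2^m
... | no N≰2^m with Fin.pigeonhole (ℕ.≰⇒> N≰2^m) (signature S c ∘ z)
...   | j₁ , j₂ , j₁<j₂ , same with separated j₁ j₂ j₁<j₂
...     | t , btw = ⊥-elim (between⇒side≢ btw (signature-side S same t))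

UnitApart : ℕ → ℕ → Set
UnitApart x y = y ≡ suc x ⊎ x ≡ suc y

module _ {f : ℕ → ℕ} {K : ℕ}
         (unit-steps : ∀ i → suc i ≤ K → UnitApart (f i) (f (suc i)))
         (no-return : ∀ i → suc (suc i) ≤ K → f i ≢ f (suc (suc i))) where

  ascending : f 1 ≡ suc (f 0) → ∀ i → suc i ≤ K → f (suc i) ≡ suc (f i)
  ascending up zero    _      = up
  ascending up (suc i) 1+i<K with unit-steps (suc i) 1+i<K
  ... | inj₁ step = step
  ... | inj₂ back = ⊥-elim (no-return i 1+i<K
          (ℕ.suc-injective (trans (sym (ascending up i (ℕ.<⇒≤ 1+i<K))) back)))

  descending : f 0 ≡ suc (f 1) → ∀ i → suc i ≤ K → f i ≡ suc (f (suc i))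
  descending down zero    _      = down
  descending down (suc i) 1+i<K with unit-steps (suc i) 1+i<K
  ... | inj₁ back = ⊥-elim (no-return i 1+i<K
          (trans (descending down i (ℕ.<⇒≤ 1+i<K)) (sym back)))
  ... | inj₂ step = step

increments⇒≡+ : ∀ {f : ℕ → ℕ} {K} → (∀ i → suc i ≤ K → f (suc i) ≡ suc (f i)) →
                ∀ i → i ≤ K → f i ≡ f 0 + i
increments⇒≡+ {f} inc zero    _     = sym (ℕ.+-identityʳ (f 0))
increments⇒≡+ {f} inc (suc i) 1+i≤K = begin
  f (suc i)      ≡⟨ inc i 1+i≤K ⟩
  suc (f i)      ≡⟨ cong suc (increments⇒≡+ inc i (ℕ.<⇒≤ 1+i≤K)) ⟩
  suc (f 0 + i)  ≡⟨ ℕ.+-suc (f 0) i ⟨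
  f 0 + suc i    ∎
  where open ≡-Reasoning

decrements⇒+≡ : ∀ {f : ℕ → ℕ} {K} → (∀ i → suc i ≤ K → f i ≡ suc (f (suc i))) →
                ∀ i → i ≤ K → f i + i ≡ f 0
decrements⇒+≡ {f} dec zero    _     = ℕ.+-identityʳ (f 0)
decrements⇒+≡ {f} dec (suc i) 1+i≤K = begin
  f (suc i) + suc i    ≡⟨ ℕ.+-suc (f (suc i)) i ⟩
  suc (f (suc i)) + i  ≡⟨ cong (_+ i) (dec i 1+i≤K) ⟨
  f i + i              ≡⟨ decrements⇒+≡ dec i (ℕ.<⇒≤ 1+i≤K) ⟩
  f 0                  ∎
  where open ≡-Reasoning

unitSteps⇒progression : ∀ {f : ℕ → ℕ} {K} →
                        (∀ i → suc i ≤ K → UnitApart (f i) (f (suc i))) →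
                        (∀ i → suc (suc i) ≤ K → f i ≢ f (suc (suc i))) →
                        (∀ i → i ≤ K → f i ≡ f 0 + i) ⊎ (∀ i → i ≤ K → f i + i ≡ f 0)
unitSteps⇒progression {f} {zero} _ _ = inj₁ λ { _ z≤n → sym (ℕ.+-identityʳ (f 0)) }
unitSteps⇒progression {f} {suc K} steps no-return with steps 0 (s≤s z≤n)
... | inj₁ up   = inj₁ (increments⇒≡+ (ascending steps no-return up))
... | inj₂ down = inj₂ (decrements⇒+≡ (descending steps no-return down))

pos-injective : ∀ {n} (R : Permutation′ n) {i j} → pos R i ≡ pos R j → i ≡ j
pos-injective R eq = trans (sym (inverseʳ R)) (trans (cong (R ⟨$⟩ʳ_) eq) (inverseʳ R))

pos≗involution⇒⟨$⟩ʳ≗ : ∀ {n} (R : Permutation′ n) {f : Fin n → Fin n} →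
                        (∀ j → pos R j ≡ f j) → (∀ j → f (f j) ≡ j) → ∀ j → R ⟨$⟩ʳ j ≡ f j
pos≗involution⇒⟨$⟩ʳ≗ R {f} pos≗f involutive j = begin
  R ⟨$⟩ʳ j              ≡⟨ cong (R ⟨$⟩ʳ_) (trans (pos≗f (f j)) (involutive j)) ⟨
  R ⟨$⟩ʳ (pos R (f j))  ≡⟨ inverseʳ R ⟩
  f j                   ∎
  where open ≡-Reasoning

toℕ-mod : ∀ {i n} .{{_ : NonZero n}} → i ℕ.< n → toℕ (i mod n) ≡ i
toℕ-mod i<n = trans (Fin.toℕ-fromℕ< _) (m<n⇒m%n≡m i<n)

<⇒adjacent⊎between : ∀ {n} {a b : Fin n} → a < b →
                     toℕ b ≡ suc (toℕ a) ⊎ ∃[ c ] (a < c × c < b)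
<⇒adjacent⊎between {a = a} {b} a<b with ℕ.m≤n⇒m<n∨m≡n a<b
... | inj₂ 1+a≡b = inj₁ (sym 1+a≡b)
... | inj₁ 1+a<b = inj₂ (c , subst (toℕ a ℕ.<_) (sym toℕ-c) (ℕ.n<1+n (toℕ a))
                           , subst (ℕ._< toℕ b) (sym toℕ-c) 1+a<b)
  where
    c = fromℕ< (ℕ.<-trans 1+a<b (Fin.toℕ<n b))
    toℕ-c : toℕ c ≡ suc (toℕ a)
    toℕ-c = Fin.toℕ-fromℕ< _

adjacent⊎between : ∀ {n} {a b : Fin n} → a ≢ b →
                   UnitApart (toℕ a) (toℕ b) ⊎ ∃[ c ] Between a c b
adjacent⊎between {a = a} {b} a≢b with Fin.<-cmp a b
... | tri≈ _ a≡b _ = ⊥-elim (a≢b a≡b)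
... | tri< a<b _ _ = Sum.map inj₁ (map₂ inj₁) (<⇒adjacent⊎between a<b)
... | tri> _ _ b<a = Sum.map inj₂ (map₂ inj₂) (<⇒adjacent⊎between b<a)

Gap : ∀ {K} → Permutation′ (suc K) → Set
Gap {K} R = ∃[ i ] ∃[ w ] Between (pos R (inject₁ {K} i)) (pos R w) (pos R (suc i))

gap? : ∀ {K} (R : Permutation′ (suc K)) → Dec (Gap R)
gap? R = Fin.any? λ i → Fin.any? λ w → between? _ _ _

noGap⇒adjacent : ∀ {K} (R : Permutation′ (suc K)) → ¬ Gap R →
                 ∀ i → UnitApart (toℕ (pos R (inject₁ i))) (toℕ (pos R (suc i)))
noGap⇒adjacent R noGap i
  with adjacent⊎between (Fin.<⇒≢ (Fin.≤̄⇒inject₁< {i = i} ℕ.≤-refl) ∘ pos-injective R)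
... | inj₁ adjacent    = adjacent
... | inj₂ (c , btw) =
  ⊥-elim (noGap (i , R ⟨$⟩ʳ c , between-cong refl (sym (inverseˡ R)) refl btw))

module _ {K : ℕ} (R : Permutation′ (suc K)) where

  -- The positions in R as a sequence of naturals; the values at indices beyond K are junk.
  posℕ : ℕ → ℕ
  posℕ i = toℕ (pos R (i mod suc K))

  posℕ-toℕ : ∀ j → posℕ (toℕ j) ≡ toℕ (pos R j)
  posℕ-toℕ j = cong (toℕ ∘ pos R) (Fin.toℕ-injective (toℕ-mod (Fin.toℕ<n j)))

  posℕ-≤ : ∀ i → posℕ i ≤ K
  posℕ-≤ i = s≤s⁻¹ (Fin.toℕ<n (pos R (i mod suc K)))

  posℕ-injective : ∀ {i j} → i ≤ K → j ≤ K → posℕ i ≡ posℕ j → i ≡ j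
  posℕ-injective {i} {j} i≤K j≤K eq = begin
    i                  ≡⟨ toℕ-mod (s≤s i≤K) ⟨
    toℕ (i mod suc K)  ≡⟨ cong toℕ (pos-injective R (Fin.toℕ-injective eq)) ⟩
    toℕ (j mod suc K)  ≡⟨ toℕ-mod (s≤s j≤K) ⟩
    j                  ∎
    where open ≡-Reasoning

  noGap⇒unitSteps : ¬ Gap R → ∀ u → suc u ≤ K → UnitApart (posℕ u) (posℕ (suc u))
  noGap⇒unitSteps noGap u u<K =
    subst₂ UnitApart (at (inject₁ i) (trans (Fin.toℕ-inject₁ i) toℕ-i))
                     (at (suc i) (cong suc toℕ-i))
      (noGap⇒adjacent R noGap i)
    where
      i = fromℕ< u<K
      toℕ-i : toℕ i ≡ u
      toℕ-i = Fin.toℕ-fromℕ< u<K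
      at : ∀ j {v} → toℕ j ≡ v → toℕ (pos R j) ≡ posℕ v
      at j refl = sym (posℕ-toℕ j)

  noReturn : ∀ i → suc (suc i) ≤ K → posℕ i ≢ posℕ (suc (suc i))
  noReturn i 2+i≤K eq =
    ℕ.m≢1+n+m i (posℕ-injective (ℕ.≤-trans (ℕ.m≤n+m i 2) 2+i≤K) 2+i≤K eq)

  progression⇒increasing : (∀ i → i ≤ K → posℕ i ≡ posℕ 0 + i) → IsIncreasing R
  progression⇒increasing up = pos≗involution⇒⟨$⟩ʳ≗ R pos≗id (λ _ → refl)
    where
      posℕ0≡0 : posℕ 0 ≡ 0
      posℕ0≡0 = ℕ.n≤0⇒n≡0 (ℕ.+-cancelʳ-≤ K (posℕ 0) 0
                  (subst (_≤ K) (up K ℕ.≤-refl) (posℕ-≤ K)))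
      pos≗id : ∀ j → pos R j ≡ j
      pos≗id j = Fin.toℕ-injective (begin
        toℕ (pos R j)        ≡⟨ posℕ-toℕ j ⟨
        posℕ (toℕ j)         ≡⟨ up (toℕ j) (s≤s⁻¹ (Fin.toℕ<n j)) ⟩
        posℕ 0 + toℕ j       ≡⟨ cong (_+ toℕ j) posℕ0≡0 ⟩
        toℕ j                ∎)
        where open ≡-Reasoning

  progression⇒decreasing : (∀ i → i ≤ K → posℕ i + i ≡ posℕ 0) → IsDecreasing R
  progression⇒decreasing down = pos≗involution⇒⟨$⟩ʳ≗ R pos≗opposite Fin.opposite-involutive
    where
      posℕ0≡K : posℕ 0 ≡ K
      posℕ0≡K = ℕ.≤-antisym (posℕ-≤ 0)
                  (subst (K ≤_) (down K ℕ.≤-refl) (ℕ.m≤n+m K (posℕ K)))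
      pos≗opposite : ∀ j → pos R j ≡ opposite j
      pos≗opposite j = Fin.toℕ-injective (begin
        toℕ (pos R j)                  ≡⟨ posℕ-toℕ j ⟨
        posℕ (toℕ j)                   ≡⟨ ℕ.m+n∸n≡m (posℕ (toℕ j)) (toℕ j) ⟨
        posℕ (toℕ j) + toℕ j ∸ toℕ j   ≡⟨ cong (_∸ toℕ j) (down (toℕ j) (s≤s⁻¹ (Fin.toℕ<n j))) ⟩
        posℕ 0 ∸ toℕ j                 ≡⟨ cong (_∸ toℕ j) posℕ0≡K ⟩
        K ∸ toℕ j                      ≡⟨ Fin.opposite-prop j ⟨
        toℕ (opposite j)               ∎)
        where open ≡-Reasoning

nonMonotone⇒gap : ∀ {K} (R : Permutation′ (suc K)) → NonMonotone R → Gap R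
nonMonotone⇒gap R (¬increasing , ¬decreasing) with gap? R
... | yes gap  = gap
... | no noGap with unitSteps⇒progression (noGap⇒unitSteps R noGap) (noReturn R)
...   | inj₁ up   = ⊥-elim (¬increasing (progression⇒increasing R up))
...   | inj₂ down = ⊥-elim (¬decreasing (progression⇒decreasing R down))

-- offset D x y u i is the shift of index i: 0 below u, x at u, y at u + 1 and D above u + 1.
offset : (D x y u i : ℕ) → ℕ
offset D x y zero    zero          = x
offset D x y zero    (suc zero)    = y
offset D x y zero    (suc (suc _)) = D
offset D x y (suc u) zero          = 0
offset D x y (suc u) (suc i)       = offset D x y u i

module _ {D x y : ℕ} where

  offset-mono : x ≤ y → y ≤ D → ∀ u {i j} → i ≤ j → offset D x y u i ≤ offset D x y u j
  offset-mono x≤y y≤D zero    {zero}        {zero}        _ = ℕ.≤-refl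
  offset-mono x≤y y≤D zero    {zero}        {suc zero}    _ = x≤y
  offset-mono x≤y y≤D zero    {zero}        {suc (suc _)} _ = ℕ.≤-trans x≤y y≤D
  offset-mono x≤y y≤D zero    {suc zero}    {suc zero}    _ = ℕ.≤-refl
  offset-mono x≤y y≤D zero    {suc zero}    {suc (suc _)} _ = y≤D
  offset-mono x≤y y≤D zero    {suc (suc _)} {suc (suc _)} _ = ℕ.≤-refl
  offset-mono x≤y y≤D zero    {suc (suc _)} {suc zero}    (s≤s ())
  offset-mono x≤y y≤D (suc u) {zero}        {_}           _ = z≤n
  offset-mono x≤y y≤D (suc u) {suc i}       {suc j}       (s≤s i≤j) = offset-mono x≤y y≤D u i≤j

  offset-≤ : x ≤ D → y ≤ D → ∀ u i → offset D x y u i ≤ D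
  offset-≤ x≤D y≤D zero    zero          = x≤D
  offset-≤ x≤D y≤D zero    (suc zero)    = y≤D
  offset-≤ x≤D y≤D zero    (suc (suc _)) = ℕ.≤-refl
  offset-≤ x≤D y≤D (suc u) zero          = z≤n
  offset-≤ x≤D y≤D (suc u) (suc i)       = offset-≤ x≤D y≤D u i

  offset-at : ∀ u → offset D x y u u ≡ x
  offset-at zero    = refl
  offset-at (suc u) = offset-at u

  offset-next : ∀ u → offset D x y u (suc u) ≡ y
  offset-next zero    = refl
  offset-next (suc u) = offset-next u

  offset-elsewhere : ∀ {x′ y′} u i → i ≢ u → i ≢ suc u →
                     offset D x y u i ≡ offset D x′ y′ u i
  offset-elsewhere zero    zero          i≢u _    = ⊥-elim (i≢u refl)
  offset-elsewhere zero    (suc zero)    _   i≢1+u = ⊥-elim (i≢1+u refl)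
  offset-elsewhere zero    (suc (suc _)) _   _    = refl
  offset-elsewhere (suc u) zero          _   _    = refl
  offset-elsewhere (suc u) (suc i)       i≢u i≢1+u =
    offset-elsewhere u i (i≢u ∘ cong suc) (i≢1+u ∘ cong suc)

spread : ∀ {K D} x y → x ≤ D → y ≤ D → ℕ → Fin (suc K) → Fin (suc K + D)
spread {D = D} x y x≤D y≤D u j =
  fromℕ< (ℕ.+-mono-<-≤ (Fin.toℕ<n j) (offset-≤ {D} {x} {y} x≤D y≤D u (toℕ j)))

toℕ-spread : ∀ {K D} x y (x≤D : x ≤ D) (y≤D : y ≤ D) u (j : Fin (suc K)) →
             toℕ (spread x y x≤D y≤D u j) ≡ toℕ j + offset D x y u (toℕ j)
toℕ-spread x y x≤D y≤D u j = Fin.toℕ-fromℕ< _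

spread-increasing : ∀ {K D} x y (x≤D : x ≤ D) (y≤D : y ≤ D) u → x ≤ y →
                    StrictlyIncreasing {suc K} (spread x y x≤D y≤D u)
spread-increasing {D = D} x y x≤D y≤D u x≤y i j i<j =
  subst₂ ℕ._<_ (sym (toℕ-spread x y x≤D y≤D u i)) (sym (toℕ-spread x y x≤D y≤D u j))
    (ℕ.+-mono-<-≤ i<j (offset-mono {D} {x} {y} x≤y y≤D u (ℕ.<⇒≤ i<j)))

module _ {K D m : ℕ} (R : Permutation′ (suc K)) (S : Fin m → Permutation′ (suc K + D))
         (covers : ∀ a → StrictlyIncreasing a → ∃[ t ] Follows a R (S t))
         {i : Fin K} {w : Fin (suc K)} (gap : Between (pos R (inject₁ i)) (pos R w) (pos R (suc i)))
         where

  private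
    u : ℕ
    u = toℕ i

  point : Fin (suc (suc D)) → Fin (suc K + D)
  point j = fromℕ< (subst (u + toℕ j ℕ.<_) (ℕ.+-suc K D)
                     (ℕ.+-mono-<-≤ (Fin.toℕ<n i) (s≤s⁻¹ (Fin.toℕ<n j))))

  toℕ-point : ∀ j → toℕ (point j) ≡ u + toℕ j
  toℕ-point j = Fin.toℕ-fromℕ< _

  centre : Fin (suc K + D)
  centre = spread 0 0 z≤n z≤n u w

  w≢u : toℕ w ≢ u
  w≢u eq = between⇒≢ˡ gap
             (cong (pos R) (Fin.toℕ-injective (trans (Fin.toℕ-inject₁ i) (sym eq))))

  w≢1+u : toℕ w ≢ suc u
  w≢1+u eq = between⇒≢ʳ gap (cong (pos R) (Fin.toℕ-injective eq))

  separated : ∀ j₁ j₂ → j₁ < j₂ →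
              ∃[ t ] Between (pos (S t) (point j₁)) (pos (S t) centre) (pos (S t) (point j₂))
  separated j₁ (suc j₂) j₁≤j₂ =
    map₂ (λ {t} follows → between-cong (cong (pos (S t)) A-at-i) (cong (pos (S t)) A-at-w)
                                       (cong (pos (S t)) A-at-1+i)
                                       (follows-between {a = A} {R} {S t} follows gap))
         (covers A (spread-increasing x y x≤D y≤D u x≤y))
    where
      open ≡-Reasoning
      x y : ℕ
      x = toℕ j₁
      y = toℕ j₂
      x≤y : x ≤ y
      x≤y = s≤s⁻¹ j₁≤j₂
      y≤D : y ≤ D
      y≤D = s≤s⁻¹ (Fin.toℕ<n j₂)
      x≤D : x ≤ D
      x≤D = ℕ.≤-trans x≤y y≤D
      A : Fin (suc K) → Fin (suc K + D)
      A = spread x y x≤D y≤D u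
      A-at-i : A (inject₁ i) ≡ point j₁
      A-at-i = Fin.toℕ-injective (begin
        toℕ (A (inject₁ i))
          ≡⟨ toℕ-spread x y x≤D y≤D u (inject₁ i) ⟩
        toℕ (inject₁ i) + offset D x y u (toℕ (inject₁ i))
          ≡⟨ cong (λ v → v + offset D x y u v) (Fin.toℕ-inject₁ i) ⟩
        u + offset D x y u u
          ≡⟨ cong (u +_) (offset-at u) ⟩
        u + x
          ≡⟨ toℕ-point j₁ ⟨
        toℕ (point j₁)
          ∎)
      A-at-1+i : A (suc i) ≡ point (suc j₂)
      A-at-1+i = Fin.toℕ-injective (begin
        toℕ (A (suc i))                  ≡⟨ toℕ-spread x y x≤D y≤D u (suc i) ⟩
        suc u + offset D x y u (suc u)   ≡⟨ cong (suc u +_) (offset-next u) ⟩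
        suc u + y                        ≡⟨ ℕ.+-suc u y ⟨
        u + suc y                        ≡⟨ toℕ-point (suc j₂) ⟨
        toℕ (point (suc j₂))             ∎)
      A-at-w : A w ≡ centre
      A-at-w = Fin.toℕ-injective (begin
        toℕ (A w)                        ≡⟨ toℕ-spread x y x≤D y≤D u w ⟩
        toℕ w + offset D x y u (toℕ w)   ≡⟨ cong (toℕ w +_) (offset-elsewhere u (toℕ w) w≢u w≢1+u) ⟩
        toℕ w + offset D 0 0 u (toℕ w)   ≡⟨ toℕ-spread 0 0 z≤n z≤n u w ⟨
        toℕ centre                       ∎)

gap⇒bound : ∀ {K D m} (R : Permutation′ (suc K)) (S : Fin m → Permutation′ (suc K + D)) →
            (∀ a → StrictlyIncreasing a → ∃[ t ] Follows a R (S t)) →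
            Gap R → suc (suc D) ≤ 2 ^ m
gap⇒bound R S covers (_ , _ , gap) =
  separated⇒≤2^ S (centre R S covers gap) (point R S covers gap) (separated R S covers gap)

lemma2p3 : (k n : ℕ) → 3 ≤ k → 3 ≤ n → k ≤ n →
    (R : Permutation′ k) → NonMonotone R →
    (m : ℕ) → (S : Fin m → Permutation′ n) →
    (∀ (a : Fin k → Fin n) → StrictlyIncreasing a → ∃[ t ] Follows a R (S t)) →
    n ∸ k + 2 ≤ 2 ^ m
lemma2p3 zero _ () _ _ _ _ _ _ _
lemma2p3 (suc K) n _ _ k≤n R nonMonotone m S covers with ℕ.m≤n⇒∃[o]m+o≡n k≤n
... | D , refl rewrite ℕ.m+n∸m≡n (suc K) D | ℕ.+-comm D 2 =
  gap⇒bound R S covers (nonMonotone⇒gap R nonMonotone)
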